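{- Let $L=(l_{i,j})$ be a Latin square of order $n$ and let $\Theta=(\alpha,\beta,\gamma)$ be an autotopism of $L$. Let $C^\alpha$ be a cycle of $\alpha$ of length $\lambda^\alpha$ and $C^\beta$ a cycle of $\beta$ of length $\lambda^\beta$, and put $m=\mathrm{lcm}(\lambda^\alpha,\lambda^\beta)$. Let $a$ be an element of $C^\alpha$, $b$ an element of $C^\beta$, and let $C^\gamma$ be the cycle of $\gamma$ containing $l_{a,b}$, of length $\lambda^\gamma$. Then: (i) $\lambda^\gamma$ divides $m$; (ii) $\lambda^\gamma$ does not divide any positive multiple of $\lambda^\alpha$ smaller than $m$; (iii) $\lambda^\gamma$ does not divide any positive multiple of $\lambda^\beta$ smaller than $m$; (iv) if $\gcd(\lambda^\alpha,\lambda^\beta)=1$, then $\lambda^\gamma=m$.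
   Context: Let $N=\{0,1,\dots,n-1\}$ and $S_n$ the symmetric group on $N$. A Latin square of order $n$ is an $n\times n$ array $L=(l_{i,j})_{i,j\in N}$ with entries in $N$ in which each symbol occurs exactly once in each row and each column. For $\Theta=(\alpha,\beta,\gamma)\in S_n^3$, $L^{\Theta}$ is the array with $(i,j)$ entry $\gamma^{ -1}(l_{\alpha(i),\beta(j)})$; $\Theta$ is an autotopism of $L$ if $L^\Theta=L$. Cycles refer to the disjoint cycle decomposition of a permutation, fixed points being cycles of length 1. -}

module Defs where

open import Data.Nat using (ℕ; zero; suc; _<_; _≤_)
open import Data.Fin using (Fin)
open import Data.Fin.Permutation using (Permutation′; _⟨$⟩ʳ_; _⟨$⟩ˡ_)
open import Data.Product using (Σ; _×_; _,_)
open import Relation.Binary.PropositionalEquality using (_≡_)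
open import Relation.Nullary using (¬_)

Array : ℕ → Set
Array n = Fin n → Fin n → Fin n

ExactlyOne : ∀ {n} → (Fin n → Set) → Set
ExactlyOne {n} P = Σ (Fin n) λ x → P x × (∀ y → P y → y ≡ x)

IsLatinSquare : ∀ {n} → Array n → Set
IsLatinSquare {n} L =
  (∀ (i s : Fin n) → ExactlyOne (λ j → L i j ≡ s)) ×
  (∀ (j s : Fin n) → ExactlyOne (λ i → L i j ≡ s))

isotope : ∀ {n} → Array n → Permutation′ n → Permutation′ n → Permutation′ n → Array n
isotope L α β γ i j = γ ⟨$⟩ˡ (L (α ⟨$⟩ʳ i) (β ⟨$⟩ʳ j))

IsAutotopism : ∀ {n} → Array n → Permutation′ n → Permutation′ n → Permutation′ n → Set
IsAutotopism {n} L α β γ = ∀ (i j : Fin n) → isotope L α β γ i j ≡ L i j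

pow : ∀ {n} → Permutation′ n → ℕ → Fin n → Fin n
pow σ zero    x = x
pow σ (suc k) x = σ ⟨$⟩ʳ (pow σ k x)

-- The cycle of σ containing x has length ℓ : ℓ is the least positive k with σ^k(x) = x
-- (the cycle of x is {x, σx, …, σ^(ℓ-1)x}, of size exactly this ℓ).
CycleLength : ∀ {n} → Permutation′ n → Fin n → ℕ → Set
CycleLength σ x ℓ = 0 < ℓ × pow σ ℓ x ≡ x × (∀ k → 0 < k → k < ℓ → ¬ (pow σ k x ≡ x))

-- Iterating L^Θ = L gives L(αᵗa, βᵗb) = γᵗ(l_{a,b}) for every t.
-- Since every row and every column of L is injective, any two of the
-- three fixed-point conditions  αᵗa = a,  βᵗb = b,  γᵗ(l_{a,b}) = l_{a,b}
-- imply the third.  A point x lies on a σ-cycle of length ℓ exactly when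
-- σᵗx = x ⇔ ℓ ∣ t, so the "two out of three" principle becomes: any two of
-- λα ∣ t, λβ ∣ t, λγ ∣ t imply the third.  Then (i) takes t = lcm;
-- (ii)/(iii) say that λγ ∣ kλα (resp. kλβ) would make kλα (resp. kλβ) a
-- positive common multiple of λα and λβ below the lcm; and (iv) uses
-- coprimality to get λα ∣ λγ and λβ ∣ λγ from λγ ∣ λαλγ and λγ ∣ λβλγ.
module Submission where

open import Defs
open import Data.Nat using (ℕ; zero; suc; _+_; _*_; _<_; _≤_; z<s; NonZero; >-nonZero)
open import Data.Nat.Properties using (<⇒≱)
open import Data.Nat.Divisibility using (_∣_; divides; ∣⇒≤; ∣-antisym; m∣m*n; n∣m*n; m%n≡0⇒n∣m)
open import Data.Nat.DivMod using (_%_; _/_; m≡m%n+[m/n]*n; m%n<n)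
open import Data.Nat.GCD using (gcd)
open import Data.Nat.LCM using (lcm; m∣lcm[m,n]; n∣lcm[m,n]; lcm-least)
open import Data.Nat.Coprimality as Coprimality using (Coprime; gcd≡1⇒coprime; coprime-divisor)
open import Data.Fin using (Fin)
open import Data.Fin.Permutation using (Permutation′; _⟨$⟩ʳ_; _⟨$⟩ˡ_; inverseʳ)
open import Data.Product using (_×_; _,_; proj₁; proj₂)
open import Data.Empty using (⊥-elim)
open import Relation.Nullary using (¬_)
open import Relation.Binary.PropositionalEquality
  using (_≡_; refl; sym; trans; cong; cong₂; subst; module ≡-Reasoning)

open ≡-Reasoning

pow-add : ∀ {n} (σ : Permutation′ n) m k x → pow σ (m + k) x ≡ pow σ m (pow σ k x)
pow-add σ zero    k x = refl
pow-add σ (suc m) k x = cong (σ ⟨$⟩ʳ_) (pow-add σ m k x)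

pow-periodic : ∀ {n} (σ : Permutation′ n) x ℓ → pow σ ℓ x ≡ x → ∀ q → pow σ (q * ℓ) x ≡ x
pow-periodic σ x ℓ period zero    = refl
pow-periodic σ x ℓ period (suc q) = begin
  pow σ (ℓ + q * ℓ) x     ≡⟨ pow-add σ ℓ (q * ℓ) x ⟩
  pow σ ℓ (pow σ (q * ℓ) x) ≡⟨ cong (pow σ ℓ) (pow-periodic σ x ℓ period q) ⟩
  pow σ ℓ x               ≡⟨ period ⟩
  x                       ∎

pow-mod : ∀ {n} (σ : Permutation′ n) x ℓ .{{_ : NonZero ℓ}} → pow σ ℓ x ≡ x →
          ∀ t → pow σ t x ≡ pow σ (t % ℓ) x
pow-mod σ x ℓ period t = begin
  pow σ t x                              ≡⟨ cong (λ k → pow σ k x) (m≡m%n+[m/n]*n t ℓ) ⟩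
  pow σ (t % ℓ + (t / ℓ) * ℓ) x          ≡⟨ pow-add σ (t % ℓ) ((t / ℓ) * ℓ) x ⟩
  pow σ (t % ℓ) (pow σ ((t / ℓ) * ℓ) x)  ≡⟨ cong (pow σ (t % ℓ)) (pow-periodic σ x ℓ period (t / ℓ)) ⟩
  pow σ (t % ℓ) x                        ∎

∣⇒fixed : ∀ {n} (σ : Permutation′ n) x ℓ → CycleLength σ x ℓ → ∀ t → ℓ ∣ t → pow σ t x ≡ x
∣⇒fixed σ x ℓ (_ , period , _) t (divides q refl) =
  pow-periodic σ x ℓ period q

-- ... and only then: a nonzero remainder t % ℓ < ℓ would contradict minimality.
fixed⇒∣ : ∀ {n} (σ : Permutation′ n) x ℓ → CycleLength σ x ℓ → ∀ t → pow σ t x ≡ x → ℓ ∣ t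
fixed⇒∣ σ x ℓ@(suc _) (_ , period , minimal) t fixed =
  remainder-zero (t % ℓ) refl (trans (sym (pow-mod σ x ℓ period t)) fixed)
  where
  remainder-zero : ∀ r → t % ℓ ≡ r → pow σ r x ≡ x → ℓ ∣ t
  remainder-zero zero    t%ℓ≡0 _      = m%n≡0⇒n∣m t ℓ t%ℓ≡0
  remainder-zero (suc r) t%ℓ≡r fixedʳ =
    ⊥-elim (minimal (suc r) z<s (subst (_< ℓ) t%ℓ≡r (m%n<n t ℓ)) fixedʳ)

exactlyOne-unique : ∀ {n} {P : Fin n → Set} → ExactlyOne P → ∀ {y z} → P y → P z → y ≡ z
exactlyOne-unique (_ , _ , unique) Py Pz = trans (unique _ Py) (sym (unique _ Pz))

row-injective : ∀ {n} {L : Array n} → IsLatinSquare L → ∀ i {j j′} → L i j ≡ L i j′ → j ≡ j′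
row-injective {L = L} latin i {j′ = j′} e = exactlyOne-unique (proj₁ latin i (L i j′)) e refl

column-injective : ∀ {n} {L : Array n} → IsLatinSquare L → ∀ j {i i′} → L i j ≡ L i′ j → i ≡ i′
column-injective {L = L} latin j {i′ = i′} e = exactlyOne-unique (proj₂ latin j (L i′ j)) e refl

module Autotopism {n} {L : Array n} {α β γ : Permutation′ n} (autotopism : IsAutotopism L α β γ) where

  step : ∀ i j → L (α ⟨$⟩ʳ i) (β ⟨$⟩ʳ j) ≡ γ ⟨$⟩ʳ L i j
  step i j = trans (sym (inverseʳ γ)) (cong (γ ⟨$⟩ʳ_) (autotopism i j))

  iterate : ∀ t i j → L (pow α t i) (pow β t j) ≡ pow γ t (L i j)
  iterate zero    i j = refl
  iterate (suc t) i j = trans (step (pow α t i) (pow β t j)) (cong (γ ⟨$⟩ʳ_) (iterate t i j))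

  module _ (latin : IsLatinSquare L) (a b : Fin n) (t : ℕ) where

    fixed-entry : pow α t a ≡ a → pow β t b ≡ b → pow γ t (L a b) ≡ L a b
    fixed-entry fixedα fixedβ = trans (sym (iterate t a b)) (cong₂ L fixedα fixedβ)

    fixed-column : pow α t a ≡ a → pow γ t (L a b) ≡ L a b → pow β t b ≡ b
    fixed-column fixedα fixedγ = row-injective latin a (begin
      L a (pow β t b)           ≡⟨ cong (λ i → L i (pow β t b)) (sym fixedα) ⟩
      L (pow α t a) (pow β t b) ≡⟨ iterate t a b ⟩
      pow γ t (L a b)           ≡⟨ fixedγ ⟩
      L a b                     ∎)

    fixed-row : pow β t b ≡ b → pow γ t (L a b) ≡ L a b → pow α t a ≡ a
    fixed-row fixedβ fixedγ = column-injective latin b (begin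
      L (pow α t a) b           ≡⟨ cong (L (pow α t a)) (sym fixedβ) ⟩
      L (pow α t a) (pow β t b) ≡⟨ iterate t a b ⟩
      pow γ t (L a b)           ≡⟨ fixedγ ⟩
      L a b                     ∎)

*-positive : ∀ {m k} → 0 < m → 0 < k → 0 < m * k
*-positive {suc _} {suc _} _ _ = z<s

lcm-minimal : ∀ {m k t} → 0 < t → m ∣ t → k ∣ t → lcm m k ≤ t
lcm-minimal t>0 m∣t k∣t = ∣⇒≤ {{>-nonZero t>0}} (lcm-least m∣t k∣t)

module CycleLengths {n} {L : Array n} {α β γ : Permutation′ n}
       (latin : IsLatinSquare L) (autotopism : IsAutotopism L α β γ)
       {a b : Fin n} {λα λβ λγ : ℕ}
       (cα : CycleLength α a λα) (cβ : CycleLength β b λβ) (cγ : CycleLength γ (L a b) λγ) where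

  open Autotopism {α = α} {β} {γ} autotopism

  λα,λβ⇒λγ : ∀ {t} → λα ∣ t → λβ ∣ t → λγ ∣ t
  λα,λβ⇒λγ {t} dα dβ = fixed⇒∣ γ (L a b) λγ cγ t
    (fixed-entry latin a b t (∣⇒fixed α a λα cα t dα) (∣⇒fixed β b λβ cβ t dβ))

  λα,λγ⇒λβ : ∀ {t} → λα ∣ t → λγ ∣ t → λβ ∣ t
  λα,λγ⇒λβ {t} dα dγ = fixed⇒∣ β b λβ cβ t
    (fixed-column latin a b t (∣⇒fixed α a λα cα t dα) (∣⇒fixed γ (L a b) λγ cγ t dγ))

  λβ,λγ⇒λα : ∀ {t} → λβ ∣ t → λγ ∣ t → λα ∣ t
  λβ,λγ⇒λα {t} dβ dγ = fixed⇒∣ α a λα cα t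
    (fixed-row latin a b t (∣⇒fixed β b λβ cβ t dβ) (∣⇒fixed γ (L a b) λγ cγ t dγ))

  λγ∣lcm : λγ ∣ lcm λα λβ
  λγ∣lcm = λα,λβ⇒λγ (m∣lcm[m,n] λα λβ) (n∣lcm[m,n] λα λβ)

  -- (ii): λγ ∣ kλα would make kλα a positive common multiple below the lcm.
  λγ∤kλα : ∀ k → 0 < k → k * λα < lcm λα λβ → ¬ (λγ ∣ k * λα)
  λγ∤kλα k k>0 below dγ = <⇒≱ below
    (lcm-minimal (*-positive k>0 (proj₁ cα)) (n∣m*n k) (λα,λγ⇒λβ (n∣m*n k) dγ))

  λγ∤kλβ : ∀ k → 0 < k → k * λβ < lcm λα λβ → ¬ (λγ ∣ k * λβ)
  λγ∤kλβ k k>0 below dγ = <⇒≱ below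
    (lcm-minimal (*-positive k>0 (proj₁ cβ)) (λβ,λγ⇒λα (n∣m*n k) dγ) (n∣m*n k))

  -- (iv): λβ ∣ λα·λγ and λα ∣ λβ·λγ; coprimality strips the other factor.
  coprime⇒λγ≡lcm : gcd λα λβ ≡ 1 → λγ ≡ lcm λα λβ
  coprime⇒λγ≡lcm gcd≡1 = ∣-antisym λγ∣lcm (lcm-least λα∣λγ λβ∣λγ)
    where
    coprime : Coprime λα λβ
    coprime = gcd≡1⇒coprime gcd≡1

    λα∣λγ : λα ∣ λγ
    λα∣λγ = coprime-divisor coprime (λβ,λγ⇒λα (m∣m*n λγ) (n∣m*n λβ))

    λβ∣λγ : λβ ∣ λγ
    λβ∣λγ = coprime-divisor (Coprimality.sym coprime) (λα,λγ⇒λβ (m∣m*n λγ) (n∣m*n λα))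

theorem2 : (n : ℕ) (L : Array n) → IsLatinSquare L →
    (α β γ : Permutation′ n) → IsAutotopism L α β γ →
    (a b : Fin n) (λα λβ λγ : ℕ) →
    CycleLength α a λα → CycleLength β b λβ → CycleLength γ (L a b) λγ →
    (λγ ∣ lcm λα λβ)
    × (∀ k → 0 < k → k * λα < lcm λα λβ → ¬ (λγ ∣ k * λα))
    × (∀ k → 0 < k → k * λβ < lcm λα λβ → ¬ (λγ ∣ k * λβ))
    × (gcd λα λβ ≡ 1 → λγ ≡ lcm λα λβ)
theorem2 n L latin α β γ autotopism a b λα λβ λγ cα cβ cγ =
  λγ∣lcm , λγ∤kλα , λγ∤kλβ , coprime⇒λγ≡lcm
  where open CycleLengths latin autotopism cα cβ cγ
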